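{- Let $P$ be a quiver and let $Q$ be obtained from $P$ by a mutation at a vertex which is a sink or a source of $P$. Then $Q$ is minimal mutation-infinite if and only if $P$ is minimal mutation-infinite.
   Context: A quiver is a finite directed graph, possibly with multiple arrows between two vertices, containing no loops and no oriented 2-cycles. Mutation at a vertex $k$ transforms a quiver as follows: (1) for every path $i \to k \to j$ add an arrow $i \to j$; (2) reverse all arrows incident to $k$; (3) remove a maximal collection of oriented 2-cycles created. A quiver is mutation-finite if only finitely many quivers (up to isomorphism) can be obtained from it by finite sequences of mutations, and mutation-infinite otherwise. A (complete) subquiver of $Q$ is a quiver obtained by deleting some vertices of $Q$ together with all arrows incident to them. A quiver is minimal mutation-infinite if it is mutation-infinite and every proper (complete) subquiver of it is mutation-finite. A sink is a vertex all of whose incident arrows point into it; a source is a vertex all of whose incident arrows point away from it. -}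

module Defs where

open import Data.Nat using (ℕ; zero; suc; _+_; _*_; _∸_; _<_)
open import Data.Fin using (Fin; _≟_)
open import Data.Fin.Permutation using (Permutation′; _⟨$⟩ʳ_)
open import Data.List using (List)
open import Data.List.Relation.Unary.Any using (Any)
open import Data.Product using (Σ; ∃; _×_; _,_)
open import Data.Sum using (_⊎_)
open import Data.Bool using (Bool; true; false)
open import Relation.Nullary using (¬_; yes; no)
open import Relation.Binary.PropositionalEquality using (_≡_)
open import Function.Bundles using (_↣_; Injection)

-- A quiver on the vertex set Fin n is given by the number of arrows
-- arr i j from i to j (quivers are considered up to isomorphism, so the
-- identity of individual parallel arrows is irrelevant).
Arrows : ℕ → Set
Arrows n = Fin n → Fin n → ℕ

record IsQuiver {n : ℕ} (a : Arrows n) : Set where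
  field
    noLoop    : ∀ i → a i i ≡ 0
    no2cycle  : ∀ i j → a i j ≡ 0 ⊎ a j i ≡ 0

-- Mutation at k:
--  * arrows incident to k are reversed;
--  * for i, j ≠ k: step (1) gives a i j + a i k * a k j arrows i → j
--    (and symmetrically j → i); step (3) cancels a maximal collection of
--    oriented 2-cycles, leaving the (truncated) difference.
mutate : ∀ {n} → Arrows n → Fin n → Arrows n
mutate {n} a k i j with i ≟ k | j ≟ k
... | yes _ | _     = a j i
... | no _  | yes _ = a j i
... | no _  | no _  =
  (a i j + a i k * a k j) ∸ (a j i + a j k * a k i)

mutateSeq : ∀ {n} → Arrows n → List (Fin n) → Arrows n
mutateSeq a List.[] = a
mutateSeq a (k List.∷ ks) = mutateSeq (mutate a k) ks

_≅_ : ∀ {n} → Arrows n → Arrows n → Set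
_≅_ {n} a b = Σ (Permutation′ n) λ σ →
  ∀ i j → b (σ ⟨$⟩ʳ i) (σ ⟨$⟩ʳ j) ≡ a i j

-- Mutation-finite: finitely many isomorphism classes in the mutation class,
-- i.e. some finite list of quivers represents every quiver obtained by a
-- finite sequence of mutations up to isomorphism.
MutationFinite : ∀ {n} → Arrows n → Set
MutationFinite {n} a = Σ (List (Arrows n)) λ L →
  ∀ (ks : List (Fin n)) → Any (λ b → mutateSeq a ks ≅ b) L

MutationInfinite : ∀ {n} → Arrows n → Set
MutationInfinite a = ¬ MutationFinite a

-- Full subquiver on the image of an injective map of vertex sets
-- (i.e. delete the remaining vertices and all arrows incident to them).
restrict : ∀ {m n} → Arrows n → (Fin m ↣ Fin n) → Arrows m
restrict a f i j = a (Injection.to f i) (Injection.to f j)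

MinimalMutationInfinite : ∀ {n} → Arrows n → Set
MinimalMutationInfinite {n} a =
  MutationInfinite a ×
  (∀ m → m < n → (f : Fin m ↣ Fin n) → MutationFinite (restrict a f))

IsSink : ∀ {n} → Arrows n → Fin n → Set
IsSink a k = ∀ j → a k j ≡ 0

IsSource : ∀ {n} → Arrows n → Fin n → Set
IsSource a k = ∀ j → a j k ≡ 0

-- Mutation at a sink or source k creates no paths through k, so it only
-- reverses the arrows at k; k is then a source or sink of the result and
-- mutating at k again restores the quiver. Hence P and Q have the same
-- mutation class. A subquiver either avoids k, and is then common to P and Q,
-- or contains k, and then the corresponding subquivers of P and Q again differ
-- by a mutation at the sink or source k.

module Submission where

open import Defs
open import Data.Nat using (ℕ; _+_; _*_; _∸_)
open import Data.Nat.Properties using (+-identityʳ; *-zeroʳ; 0∸n≡0)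
open import Data.Fin using (Fin; _≟_)
open import Data.Fin.Properties using (any?)
open import Data.Sum using (_⊎_; inj₁; inj₂; swap)
import Data.Sum as Sum
open import Data.Product using (_×_; _,_)
open import Data.List using ([]; _∷_)
import Data.List.Relation.Unary.Any as Any
open import Data.Empty using (⊥-elim)
open import Relation.Nullary using (yes; no)
open import Relation.Binary.PropositionalEquality
open import Function using (_∘′_)
open import Function.Bundles using (_⇔_; mk⇔; _↣_; Injection; Equivalence)
import Function.Properties.Equivalence as ⇔

infix 4 _≗₂_

_≗₂_ : ∀ {n} → Arrows n → Arrows n → Set
a ≗₂ b = ∀ i j → a i j ≡ b i j

SinkOrSource : ∀ {n} → Arrows n → Fin n → Set
SinkOrSource a k = IsSink a k ⊎ IsSource a k

mutate-incident : ∀ {n} (a : Arrows n) k i j → i ≡ k ⊎ j ≡ k →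
  mutate a k i j ≡ a j i
mutate-incident a k i j incident with i ≟ k | j ≟ k | incident
... | yes _  | _      | _        = refl
... | no _   | yes _  | _        = refl
... | no i≢k | no _   | inj₁ i≡k = ⊥-elim (i≢k i≡k)
... | no _   | no j≢k | inj₂ j≡k = ⊥-elim (j≢k j≡k)

mutate-nonincident : ∀ {n} (a : Arrows n) k i j → i ≢ k → j ≢ k →
  mutate a k i j ≡ (a i j + a i k * a k j) ∸ (a j i + a j k * a k i)
mutate-nonincident a k i j i≢k j≢k with i ≟ k | j ≟ k
... | yes i≡k | _       = ⊥-elim (i≢k i≡k)
... | no _    | yes j≡k = ⊥-elim (j≢k j≡k)
... | no _    | no _    = refl

incident? : ∀ {n} (k i j : Fin n) → (i ≡ k ⊎ j ≡ k) ⊎ (i ≢ k × j ≢ k)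
incident? k i j with i ≟ k | j ≟ k
... | yes i≡k | _       = inj₁ (inj₁ i≡k)
... | no _    | yes j≡k = inj₁ (inj₂ j≡k)
... | no i≢k  | no j≢k  = inj₂ (i≢k , j≢k)

mutate-cong : ∀ {n} {a b : Arrows n} → a ≗₂ b → ∀ k → mutate a k ≗₂ mutate b k
mutate-cong {a = a} {b} a≗b k i j with i ≟ k | j ≟ k
... | yes _ | _     = a≗b j i
... | no _  | yes _ = a≗b j i
... | no _  | no _  = cong₂ _∸_
  (cong₂ _+_ (a≗b i j) (cong₂ _*_ (a≗b i k) (a≗b k j)))
  (cong₂ _+_ (a≗b j i) (cong₂ _*_ (a≗b j k) (a≗b k i)))

mutateSeq-cong : ∀ {n} {a b : Arrows n} → a ≗₂ b → ∀ ks →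
  mutateSeq a ks ≗₂ mutateSeq b ks
mutateSeq-cong a≗b []       = a≗b
mutateSeq-cong a≗b (k ∷ ks) = mutateSeq-cong (mutate-cong a≗b k) ks

no2cycle-cancel : ∀ {n} {a : Arrows n} → IsQuiver a → ∀ i j →
  (a i j + 0) ∸ (a j i + 0) ≡ a i j
no2cycle-cancel {a = a} q i j
  rewrite +-identityʳ (a i j) | +-identityʳ (a j i)
  with IsQuiver.no2cycle q i j
... | inj₁ aij≡0 rewrite aij≡0 = 0∸n≡0 (a j i)
... | inj₂ aji≡0 rewrite aji≡0 = refl

sinkOrSource-noPath : ∀ {n} {a : Arrows n} {k} → SinkOrSource a k →
  ∀ i j → a i k * a k j ≡ 0
sinkOrSource-noPath {a = a} (inj₁ sink)   i j rewrite sink j = *-zeroʳ (a i _)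
sinkOrSource-noPath         (inj₂ source) i j rewrite source i = refl

mutate-sinkOrSource-nonincident : ∀ {n} {a : Arrows n} {k} → IsQuiver a →
  SinkOrSource a k → ∀ i j → i ≢ k → j ≢ k → mutate a k i j ≡ a i j
mutate-sinkOrSource-nonincident {a = a} {k} q s i j i≢k j≢k = begin
  mutate a k i j                                       ≡⟨ mutate-nonincident a k i j i≢k j≢k ⟩
  (a i j + a i k * a k j) ∸ (a j i + a j k * a k i)    ≡⟨ cong₂ (λ x y → (a i j + x) ∸ (a j i + y))
                                                            (sinkOrSource-noPath {a = a} s i j)
                                                            (sinkOrSource-noPath {a = a} s j i) ⟩
  (a i j + 0) ∸ (a j i + 0)                            ≡⟨ no2cycle-cancel q i j ⟩
  a i j                                                ∎
  where open ≡-Reasoning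

mutate-sinkOrSource : ∀ {n} {a : Arrows n} {k} → SinkOrSource a k →
  SinkOrSource (mutate a k) k
mutate-sinkOrSource {a = a} {k} (inj₁ sink) =
  inj₂ λ j → trans (mutate-incident a k j k (inj₂ refl)) (sink j)
mutate-sinkOrSource {a = a} {k} (inj₂ source) =
  inj₁ λ j → trans (mutate-incident a k k j (inj₁ refl)) (source j)

mutate-isQuiver : ∀ {n} {a : Arrows n} {k} → IsQuiver a → SinkOrSource a k →
  IsQuiver (mutate a k)
mutate-isQuiver {a = a} {k} q s = record { noLoop = noLoop ; no2cycle = no2cycle }
  where
  noLoop : ∀ i → mutate a k i i ≡ 0
  noLoop i with incident? k i i
  ... | inj₁ incident = trans (mutate-incident a k i i incident) (IsQuiver.noLoop q i)
  ... | inj₂ (i≢k , _) = trans (mutate-sinkOrSource-nonincident q s i i i≢k i≢k)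
                               (IsQuiver.noLoop q i)

  no2cycle : ∀ i j → mutate a k i j ≡ 0 ⊎ mutate a k j i ≡ 0
  no2cycle i j with incident? k i j
  ... | inj₁ incident rewrite mutate-incident a k i j incident
                            | mutate-incident a k j i (swap incident)
                            = IsQuiver.no2cycle q j i
  ... | inj₂ (i≢k , j≢k) rewrite mutate-sinkOrSource-nonincident q s i j i≢k j≢k
                              | mutate-sinkOrSource-nonincident q s j i j≢k i≢k
                              = IsQuiver.no2cycle q i j

mutate-sinkOrSource-involutive : ∀ {n} {a : Arrows n} {k} → IsQuiver a →
  SinkOrSource a k → mutate (mutate a k) k ≗₂ a
mutate-sinkOrSource-involutive {a = a} {k} q s i j with incident? k i j
... | inj₁ incident = trans (mutate-incident (mutate a k) k i j incident)
                            (mutate-incident a k j i (swap incident))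
... | inj₂ (i≢k , j≢k) =
  trans (mutate-sinkOrSource-nonincident (mutate-isQuiver q s) (mutate-sinkOrSource s)
                                         i j i≢k j≢k)
        (mutate-sinkOrSource-nonincident q s i j i≢k j≢k)

mutationFinite-resp : ∀ {n} {a b : Arrows n} → a ≗₂ b →
  MutationFinite a → MutationFinite b
mutationFinite-resp a≗b (L , represents) = L , λ ks →
  Any.map (λ { (σ , iso) → σ , λ i j → trans (iso i j) (mutateSeq-cong a≗b ks i j) })
          (represents ks)

mutationFinite-resp-⇔ : ∀ {n} {a b : Arrows n} → a ≗₂ b →
  MutationFinite a ⇔ MutationFinite b
mutationFinite-resp-⇔ a≗b =
  mk⇔ (mutationFinite-resp a≗b) (mutationFinite-resp (λ i j → sym (a≗b i j)))

mutate-mutationFinite : ∀ {n} {a : Arrows n} k → MutationFinite a →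
  MutationFinite (mutate a k)
mutate-mutationFinite k (L , represents) = L , λ ks → represents (k ∷ ks)

mutate-sinkOrSource-mutationFinite-⇔ : ∀ {n} {a : Arrows n} {k} → IsQuiver a →
  SinkOrSource a k → MutationFinite (mutate a k) ⇔ MutationFinite a
mutate-sinkOrSource-mutationFinite-⇔ {k = k} q s = mk⇔
  (λ mf → mutationFinite-resp (mutate-sinkOrSource-involutive q s)
                              (mutate-mutationFinite k mf))
  (mutate-mutationFinite k)

module _ {m n : ℕ} (f : Fin m ↣ Fin n) where
  open Injection f using (to; injective)

  restrict-isQuiver : ∀ {a : Arrows n} → IsQuiver a → IsQuiver (restrict a f)
  restrict-isQuiver q = record
    { noLoop   = λ i → IsQuiver.noLoop q (to i)
    ; no2cycle = λ i j → IsQuiver.no2cycle q (to i) (to j)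
    }

  restrict-sinkOrSource : ∀ {a : Arrows n} k → SinkOrSource a (to k) →
    SinkOrSource (restrict a f) k
  restrict-sinkOrSource k (inj₁ sink)   = inj₁ λ j → sink (to j)
  restrict-sinkOrSource k (inj₂ source) = inj₂ λ j → source (to j)

  restrict-mutate : ∀ (a : Arrows n) k →
    restrict (mutate a (to k)) f ≗₂ mutate (restrict a f) k
  restrict-mutate a k i j with incident? k i j
  ... | inj₁ incident =
    trans (mutate-incident a (to k) (to i) (to j) (Sum.map (cong to) (cong to) incident))
          (sym (mutate-incident (restrict a f) k i j incident))
  ... | inj₂ (i≢k , j≢k) =
    trans (mutate-nonincident a (to k) (to i) (to j) (i≢k ∘′ injective) (j≢k ∘′ injective))
          (sym (mutate-nonincident (restrict a f) k i j i≢k j≢k))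

  restrict-mutate-mutationFinite-⇔ : ∀ {a : Arrows n} {k} → IsQuiver a →
    SinkOrSource a k →
    MutationFinite (restrict (mutate a k) f) ⇔ MutationFinite (restrict a f)
  restrict-mutate-mutationFinite-⇔ {a} {k} q s with any? (λ i → to i ≟ k)
  ... | yes (k′ , refl) =
    ⇔.trans (mutationFinite-resp-⇔ (restrict-mutate a k′))
            (mutate-sinkOrSource-mutationFinite-⇔ (restrict-isQuiver q)
                                                 (restrict-sinkOrSource {a = a} k′ s))
  ... | no k∉image = mutationFinite-resp-⇔ λ i j →
    mutate-sinkOrSource-nonincident q s (to i) (to j)
      (λ e → k∉image (i , e)) (λ e → k∉image (j , e))

minimalMutationInfinite-⇔ : ∀ {n} {a b : Arrows n} →
  MutationFinite a ⇔ MutationFinite b →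
  (∀ {m} (f : Fin m ↣ Fin n) →
     MutationFinite (restrict a f) ⇔ MutationFinite (restrict b f)) →
  MinimalMutationInfinite a ⇔ MinimalMutationInfinite b
minimalMutationInfinite-⇔ mf⇔ sub⇔ = mk⇔
  (λ { (infinite , minimal) →
         (λ mf → infinite (Equivalence.from mf⇔ mf))
       , λ m m<n f → Equivalence.to (sub⇔ f) (minimal m m<n f) })
  (λ { (infinite , minimal) →
         (λ mf → infinite (Equivalence.to mf⇔ mf))
       , λ m m<n f → Equivalence.from (sub⇔ f) (minimal m m<n f) })

proposition2p9 : ∀ (n : ℕ) (P : Arrows n) → IsQuiver P → (k : Fin n) →
    (IsSink P k ⊎ IsSource P k) →
    MinimalMutationInfinite (mutate P k) ⇔ MinimalMutationInfinite P
proposition2p9 n P q k s = minimalMutationInfinite-⇔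
  (mutate-sinkOrSource-mutationFinite-⇔ q s)
  (λ f → restrict-mutate-mutationFinite-⇔ f q s)
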